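{- Let $T$ be a triangle in the Euclidean plane whose three side lengths all lie in $\sqrt3\,\mathbb N=\{k\sqrt3 : k\in\mathbb N\}$ and whose area lies in $\frac{\sqrt3}{4}\mathbb N=\{\frac{k\sqrt3}{4}: k\in\mathbb N\}$, and suppose that the perimeter of $T$ is strictly greater than its area. Then, up to the ordering of the sides, either $T$ is the equilateral triangle with side length $3\sqrt3$, or $T$ belongs to one of the following three families: (a) $T$ has side lengths $x\sqrt3,\ x\sqrt3,\ \sqrt3$, where $1=4x^2-3y^2$ for some $x,y\in\mathbb N$; (b) $T$ has side lengths $x\sqrt3,\ x\sqrt3,\ 2\sqrt3$, where $1=x^2-3y^2$ for some $x,y\in\mathbb N$; (c) $T$ has side lengths $(3x+1)\sqrt3,\ (3x-1)\sqrt3,\ 3\sqrt3$, where $1=4x^2-15y^2$ for some $x,y\in\mathbb N$.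
   Context: Here $\mathbb N=\{1,2,3,\dots\}$ denotes the positive integers. A triangle means a non-degenerate triangle (positive area). -}

module Defs where

open import Data.Nat using (ℕ; _+_; _*_; _∸_; _<_; _≤_)
open import Data.Product using (_×_)
open import Data.List using (List; _∷_; [])
open import Relation.Binary.PropositionalEquality using (_≡_)

-- A triangle whose side lengths are a√3, b√3, c√3 (a b c : ℕ, positive) is
-- encoded by the triple (a , b , c).  Non-degeneracy = strict triangle
-- inequalities.
IsTriangle : ℕ → ℕ → ℕ → Set
IsTriangle a b c = (1 ≤ a × 1 ≤ b × 1 ≤ c) × (a < b + c × b < a + c × c < a + b)

-- Heron: 16·Area² = (p)(p-2a)(p-2b)(p-2c) for sides a,b,c.
-- With sides a√3,b√3,c√3 this is 9·heron a b c, where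
heron : ℕ → ℕ → ℕ → ℕ
heron a b c = (a + b + c) * ((b + c) ∸ a) * ((a + c) ∸ b) * ((a + b) ∸ c)

-- Area of the triangle (a√3,b√3,c√3) equals k√3/4
--   ⇔ 16·Area² = 3k²  ⇔ 9·heron = 3k²  ⇔ 3·heron = k².
AreaIs : ℕ → ℕ → ℕ → ℕ → Set
AreaIs a b c k = 3 * heron a b c ≡ k * k

-- Perimeter (a+b+c)√3 strictly greater than area k√3/4.
PerimGtArea : ℕ → ℕ → ℕ → ℕ → Set
PerimGtArea a b c k = k < 4 * (a + b + c)

sides : ℕ → ℕ → ℕ → List ℕ
sides a b c = a ∷ b ∷ c ∷ []

{-# OPTIONS --safe #-}
module Submission where

-- Put u = b + c − a, v = a + c − b, w = a + b − c (the Ravi substitution; the three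
-- have equal parity).  Heron's formula turns the area condition into
-- 3 (u + v + w) u v w = k², and perimeter > area into 3 u v w < 16 (u + v + w).  For
-- u ≤ v ≤ w this forces u v < 16.  If u v ≥ 6 it also bounds w, and a finite search
-- leaves only u = v = w = 3.  Otherwise (u , v) is (1,1), (2,2), (1,5) or (1,3) with w
-- free.  Dividing the primes 2, 3 and 5 out of the square k² turns the area condition
-- for the first three pairs into the Pell equations of families (a), (b) and (c); for
-- (1,3) it says that (w + 4) w is a square, which is impossible since it lies strictly
-- between (w + 1)² and (w + 2)².

open import Defs
open import Data.List.Base using (List; _∷_; [])
open import Data.List.Relation.Binary.Permutation.Propositional using (_↭_; ↭-refl; ↭-trans; prep; swap)
open import Data.Nat
open import Data.Nat.Divisibility using (_∣_; _∣?_; divides; ∣1⇒≡1; ∣m+n∣m⇒∣n; m∣m*n)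
open import Data.Nat.Primality using (Prime; prime?; prime[2]; ¬prime[1]; prime⇒nonZero; euclidsLemma)
open import Data.Nat.Properties
open import Data.Nat.Tactic.RingSolver using (solve)
open import Data.Product using (_×_; ∃-syntax; _,_; map₂)
open import Data.Sum using (_⊎_; inj₁; inj₂; [_,_]′)
open import Function using (id)
open import Relation.Nullary using (¬_; contradiction; yes; no)
open import Relation.Nullary.Decidable using (from-yes; from-no; _→-dec_; _×-dec_; _⊎-dec_)
open import Relation.Binary.PropositionalEquality
open import Algebra.Properties.CommutativeSemigroup +-commutativeSemigroup using () renaming (xy∙z≈xz∙y to [m+n]+o≡[m+o]+n)
open import Algebra.Properties.CommutativeSemigroup *-commutativeSemigroup using () renaming (xy∙z≈xz∙y to [m*n]*o≡[m*o]*n; x∙yz≈y∙xz to m*[n*o]≡n*[m*o])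

prime[3] : Prime 3
prime[3] = from-yes (prime? 3)

prime[5] : Prime 5
prime[5] = from-yes (prime? 5)

prime∤1 : ∀ {p} → Prime p → ¬ p ∣ 1
prime∤1 pr p∣1 = ¬prime[1] (subst Prime (∣1⇒≡1 p∣1) pr)

prime∣c*[m*m]⇒∣m : ∀ {p c m} → Prime p → ¬ p ∣ c → p ∣ c * (m * m) → p ∣ m
prime∣c*[m*m]⇒∣m {c = c} {m} pr p∤c p∣cmm with euclidsLemma c (m * m) pr p∣cmm
... | inj₁ p∣c   = contradiction p∣c p∤c
... | inj₂ p∣m*m = [ id , id ]′ (euclidsLemma m m pr p∣m*m)

-- Opaque: a with-abstraction over a use of these lemmas would otherwise unfold their
-- proofs, which exhausts memory.
opaque
  prime-descent : ∀ {p} c {k m n} → Prime p → ¬ p ∣ c → c * (k * k) + p * m ≡ p * n →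
                  ∃[ q ] k ≡ q * p × c * p * (q * q) + m ≡ n
  prime-descent {p} c {k} {m} {n} pr p∤c eq
    with divides q refl ← prime∣c*[m*m]⇒∣m {m = k} pr p∤c
           (∣m+n∣m⇒∣n (subst (p ∣_) (trans (sym eq) (+-comm _ (p * m))) (m∣m*n n)) (m∣m*n m))
    = q , refl , *-cancelˡ-≡ _ _ p {{prime⇒nonZero pr}} (begin
        p * (c * p * (q * q) + m)      ≡⟨ solve (p ∷ c ∷ q ∷ m ∷ []) ⟩
        c * (q * p * (q * p)) + p * m  ≡⟨ eq ⟩
        p * n                          ∎)
    where open ≡-Reasoning

  k*k≡p*n⇒n≡p*q*q : ∀ {p k n} → Prime p → k * k ≡ p * n → ∃[ q ] n ≡ p * (q * q)
  k*k≡p*n⇒n≡p*q*q {p} {k} {n} pr eq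
    with q , _ , e ← prime-descent 1 {k} {0} {n} pr (prime∤1 pr)
                       (trans (cong₂ _+_ (*-identityˡ (k * k)) (*-zeroʳ p)) (trans (+-identityʳ (k * k)) eq))
    = q , trans (sym e) (trans (+-identityʳ _) (cong (_* (q * q)) (*-identityˡ p)))

  k*k≡p*[p*n]⇒n≡q*q : ∀ {p k n} → Prime p → k * k ≡ p * (p * n) → ∃[ q ] n ≡ q * q
  k*k≡p*[p*n]⇒n≡q*q {p} {k} {n} pr eq =
    map₂ (*-cancelˡ-≡ _ _ p {{prime⇒nonZero pr}}) (k*k≡p*n⇒n≡p*q*q {k = k} {p * n} pr eq)

m*m<n*n⇒m<n : ∀ {m n} → m * m < n * n → m < n
m*m<n*n⇒m<n {m} {n} m*m<n*n = ≰⇒> (λ n≤m → <⇒≱ m*m<n*n (*-mono-≤ n≤m n≤m))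

nonsquare-between : ∀ {n m k} → n * n < m → m < suc n * suc n → m ≢ k * k
nonsquare-between {n} {k = k} n*n<m m<[1+n]² refl =
  <⇒≱ (m*m<n*n⇒m<n {n} {k} n*n<m) (s≤s⁻¹ (m*m<n*n⇒m<n {k} {suc n} m<[1+n]²))

nonsquare-[4+n]*n : ∀ {n q} → 1 ≤ n → (4 + n) * n ≢ q * q
nonsquare-[4+n]*n {suc n} {q} _ = nonsquare-between {2 + n} {k = q} below above
  where
  open ≤-Reasoning
  below : (2 + n) * (2 + n) < (5 + n) * (1 + n)
  below = begin-strict
    (2 + n) * (2 + n)                <⟨ m<m+n _ z<s ⟩
    (2 + n) * (2 + n) + (1 + 2 * n)  ≡⟨ solve (n ∷ []) ⟩
    (5 + n) * (1 + n)                ∎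
  above : (5 + n) * (1 + n) < (3 + n) * (3 + n)
  above = begin-strict
    (5 + n) * (1 + n)      <⟨ m<m+n _ z<s ⟩
    (5 + n) * (1 + n) + 4  ≡⟨ solve (n ∷ []) ⟩
    (3 + n) * (3 + n)      ∎

4*n≢1 : ∀ n → 4 * n ≢ 1
4*n≢1 n eq = contradiction (m*n≡1⇒m≡1 4 n eq) λ ()

nontrivial-pell : ∀ {n d y} → n ≢ 1 → n ≡ 1 + d * (y * y) → 1 ≤ y
nontrivial-pell {d = d} {y = zero}  n≢1 eq = contradiction (trans eq (cong suc (*-zeroʳ d))) n≢1
nontrivial-pell         {y = suc _} _   _  = s≤s z≤n

pell[4,3] : ∀ {k n b} → k * k ≡ 3 * n → n + 1 ≡ 4 * (b * b) →
            ∃[ y ] (1 ≤ y × 4 * (b * b) ≡ 1 + 3 * (y * y))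
pell[4,3] {k} {n} {b} k*k≡3n n+1≡4b²
  with y , refl ← k*k≡p*n⇒n≡p*q*q {k = k} {n} prime[3] k*k≡3n
  = y , nontrivial-pell {d = 3} (4*n≢1 (b * b)) pell , pell
  where
  pell : 4 * (b * b) ≡ 1 + 3 * (y * y)
  pell = trans (sym n+1≡4b²) (+-comm (3 * (y * y)) 1)

pell[1,3] : ∀ {k n b} → 1 < b → k * k ≡ 12 * n → n + 4 ≡ 4 * (b * b) →
            ∃[ y ] (1 ≤ y × b * b ≡ 1 + 3 * (y * y))
pell[1,3] {k} {n} {b} 1<b k*k≡12n n+4≡4b²
  with j , 3n≡j*j ← k*k≡p*[p*n]⇒n≡q*q {k = k} {3 * n} prime[2]
                      (trans k*k≡12n (trans (*-assoc 2 6 n) (cong (2 *_) (*-assoc 2 3 n))))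
  with q , refl   ← k*k≡p*n⇒n≡p*q*q {k = j} {n} prime[3] (sym 3n≡j*j)
  with y , _ , e  ← prime-descent 3 {q} {2} {2 * (b * b)} prime[2] (from-no (2 ∣? 3))
                      (trans n+4≡4b² (*-assoc 2 2 (b * b)))
  = y , nontrivial-pell {d = 3} b*b≢1 pell , pell
  where
  b*b≢1 : b * b ≢ 1
  b*b≢1 eq = >⇒≢ 1<b (m*n≡1⇒m≡1 b b eq)
  pell : b * b ≡ 1 + 3 * (y * y)
  pell = *-cancelˡ-≡ _ _ 2 (begin
    2 * (b * b)            ≡⟨ sym e ⟩
    3 * 2 * (y * y) + 2    ≡⟨ solve (y ∷ []) ⟩
    2 * (1 + 3 * (y * y))  ∎)
    where open ≡-Reasoning

pell[4,15] : ∀ {k n h} → k * k ≡ 15 * n → n + 9 ≡ 4 * (h * h) →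
             ∃[ x ] ∃[ y ] (h ≡ x * 3 × 1 ≤ y × 4 * (x * x) ≡ 1 + 15 * (y * y))
pell[4,15] {k} {n} {h} k*k≡15n n+9≡4h²
  with q , 5n≡3q²     ← k*k≡p*n⇒n≡p*q*q {k = k} {5 * n} prime[3] (trans k*k≡15n (*-assoc 3 5 n))
  with r , _ , refl   ← prime-descent 3 {q} {0} {n} prime[5] (from-no (5 ∣? 3))
                          (trans (+-identityʳ _) (sym 5n≡3q²))
  with x , h≡x*3 , e₃ ← prime-descent 4 {h} {0} {5 * (r * r) + 3} prime[3] (from-no (3 ∣? 4))
                          (trans (+-identityʳ _) (trans (sym n+9≡4h²) (solve (r ∷ []))))
  with y , _ , e₄     ← prime-descent 5 {r} {1} {4 * (x * x)} prime[3] (from-no (3 ∣? 5))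
                          (trans (sym e₃) (solve (x ∷ [])))
  = x , y , h≡x*3 , nontrivial-pell {d = 15} (4*n≢1 (x * x)) pell , pell
  where
  pell : 4 * (x * x) ≡ 1 + 15 * (y * y)
  pell = trans (sym e₄) (+-comm (15 * (y * y)) 1)

module _ {P : ℕ → ℕ → ℕ → Set} {Q : List ℕ → Set}
         (Q-resp-↭ : ∀ {xs ys} → xs ↭ ys → Q ys → Q xs)
         (P-swap₁₂ : ∀ {a b c} → P a b c → P b a c)
         (P-swap₂₃ : ∀ {a b c} → P a b c → P a c b)
         (sorted : ∀ {a b c} → c ≤ b → b ≤ a → P a b c → Q (sides a b c))
         where

  private
    largest-first : ∀ {a b c} → b ≤ a → P a b c → Q (sides a b c)
    largest-first {a} {b} {c} b≤a p with ≤-total c b | ≤-total c a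
    ... | inj₁ c≤b | _        = sorted c≤b b≤a p
    ... | inj₂ b≤c | inj₁ c≤a = Q-resp-↭ (prep a (swap b c ↭-refl)) (sorted b≤c c≤a (P-swap₂₃ p))
    ... | inj₂ b≤c | inj₂ a≤c = Q-resp-↭ (↭-trans (prep a (swap b c ↭-refl)) (swap a c ↭-refl))
                                          (sorted b≤a a≤c (P-swap₁₂ (P-swap₂₃ p)))

  sorted-wlog : ∀ {a b c} → P a b c → Q (sides a b c)
  sorted-wlog {a} {b} p with ≤-total b a
  ... | inj₁ b≤a = largest-first b≤a p
  ... | inj₂ a≤b = Q-resp-↭ (swap a b ↭-refl) (largest-first a≤b (P-swap₁₂ p))

halve : ∀ {m n} → 2 * m ≡ 2 * n → m ≡ n
halve = *-cancelˡ-≡ _ _ 2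

sides-cong : ∀ {a b c a′ b′ c′} → a ≡ a′ → b ≡ b′ → c ≡ c′ → sides a b c ↭ sides a′ b′ c′
sides-cong refl refl refl = ↭-refl

m≡2*n⇒2∣m : ∀ {m n} → m ≡ 2 * n → 2 ∣ m
m≡2*n⇒2∣m {n = n} eq = divides n (trans eq (*-comm 2 n))

ravi-sum : ∀ {a b c u v} → u + a ≡ b + c → v + b ≡ a + c → u + v ≡ 2 * c
ravi-sum {a} {b} {c} {u} {v} eu ev = +-cancelʳ-≡ (a + b) (u + v) (2 * c) (begin
  u + v + (a + b)    ≡⟨ solve (u ∷ v ∷ a ∷ b ∷ []) ⟩
  (u + a) + (v + b)  ≡⟨ cong₂ _+_ eu ev ⟩
  (b + c) + (a + c)  ≡⟨ solve (a ∷ b ∷ c ∷ []) ⟩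
  2 * c + (a + b)    ∎)
  where open ≡-Reasoning

ravi-perimeter : ∀ {a b c u v w} → u + v ≡ 2 * c → u + w ≡ 2 * b → v + w ≡ 2 * a → u + v + w ≡ a + b + c
ravi-perimeter {a} {b} {c} {u} {v} {w} E₁ E₂ E₃ = halve (begin
  2 * (u + v + w)              ≡⟨ solve (u ∷ v ∷ w ∷ []) ⟩
  (u + v) + (u + w) + (v + w)  ≡⟨ cong₂ _+_ (cong₂ _+_ E₁ E₂) E₃ ⟩
  2 * c + 2 * b + 2 * a        ≡⟨ solve (a ∷ b ∷ c ∷ []) ⟩
  2 * (a + b + c)              ∎)
  where open ≡-Reasoning

ravi-area : ∀ s u v w {k} → 3 * (s * u * v * w) ≡ k * k → k * k ≡ 3 * (u * v) * (s * w)
ravi-area s u v w eq = trans (sym eq) (solve (s ∷ u ∷ v ∷ w ∷ []))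

ravi-square : ∀ c {w m} → c + w ≡ 2 * m → (c + c + w) * w + c * c ≡ 4 * (m * m)
ravi-square c {w} {m} c+w≡2m = begin
  (c + c + w) * w + c * c  ≡⟨ solve (c ∷ w ∷ []) ⟩
  (c + w) * (c + w)        ≡⟨ cong (λ t → t * t) c+w≡2m ⟩
  2 * m * (2 * m)          ≡⟨ solve (m ∷ []) ⟩
  4 * (m * m)              ∎
  where open ≡-Reasoning

ravi-bound : ∀ {s u v w k} → 3 * (s * u * v * w) ≡ k * k → k < 4 * s → 3 * (u * v * w) < 16 * s
ravi-bound {s} {u} {v} {w} {k} eq k<4s = *-cancelˡ-< s _ _ (begin-strict
  s * (3 * (u * v * w))  ≡⟨ solve (s ∷ u ∷ v ∷ w ∷ []) ⟩
  3 * (s * u * v * w)    ≡⟨ eq ⟩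
  k * k                  <⟨ *-mono-< k<4s k<4s ⟩
  4 * s * (4 * s)        ≡⟨ solve (s ∷ []) ⟩
  s * (16 * s)           ∎)
  where open ≤-Reasoning

u*v<16 : ∀ {u v w} → u ≤ v → v ≤ w → 3 * (u * v * w) < 16 * (u + v + w) → u * v < 16
u*v<16 {u} {v} {w} u≤v v≤w bound = *-cancelʳ-< w (u * v) 16 (*-cancelˡ-< 3 _ _ (begin-strict
  3 * (u * v * w)   <⟨ bound ⟩
  16 * (u + v + w)  ≤⟨ *-monoʳ-≤ 16 (+-mono-≤ (+-mono-≤ (≤-trans u≤v v≤w) v≤w) (≤-refl {w})) ⟩
  16 * (w + w + w)  ≡⟨ cong (16 *_) w+w+w≡3*w ⟩
  16 * (3 * w)      ≡⟨ m*[n*o]≡n*[m*o] 16 3 w ⟩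
  3 * (16 * w)      ∎))
  where
  open ≤-Reasoning
  w+w+w≡3*w : w + w + w ≡ 3 * w
  w+w+w≡3*w = solve (w ∷ [])

w<8[u+v] : ∀ {u v w} → 6 ≤ u * v → 3 * (u * v * w) < 16 * (u + v + w) → w < 8 * (u + v)
w<8[u+v] {u} {v} {w} 6≤uv bound =
  *-cancelˡ-< 2 w (8 * (u + v)) (+-cancelʳ-< (16 * w) (2 * w) (2 * (8 * (u + v))) (begin-strict
    2 * w + 16 * w              ≡⟨ solve (w ∷ []) ⟩
    3 * (6 * w)                 ≤⟨ *-monoʳ-≤ 3 (*-monoˡ-≤ w 6≤uv) ⟩
    3 * (u * v * w)             <⟨ bound ⟩
    16 * (u + v + w)            ≡⟨ solve (u ∷ v ∷ w ∷ []) ⟩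
    2 * (8 * (u + v)) + 16 * w  ∎))
  where open ≤-Reasoning

RaviPair : ℕ → ℕ → Set
RaviPair u v = (u ≡ 1 × v ≡ 1) ⊎ (u ≡ 1 × v ≡ 3) ⊎ (u ≡ 1 × v ≡ 5) ⊎ (u ≡ 2 × v ≡ 2)

small-ravi-pair : ∀ {u v} → 1 ≤ u → u ≤ v → u * v < 6 → 2 ∣ u + v → RaviPair u v
small-ravi-pair {u} {v} 1≤u u≤v u*v<6 = enumeration (≤-<-trans u≤v v<6) v<6 1≤u u≤v u*v<6
  where
  v<6 : v < 6
  v<6 = ≤-<-trans (m≤n*m v u {{>-nonZero 1≤u}}) u*v<6
  enumeration : ∀ {u} → u < 6 → ∀ {v} → v < 6 → 1 ≤ u → u ≤ v → u * v < 6 → 2 ∣ u + v → RaviPair u v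
  enumeration = from-yes (allUpTo? (λ u → allUpTo? (λ v →
    (1 ≤? u) →-dec (u ≤? v) →-dec (u * v <? 6) →-dec (2 ∣? u + v) →-dec
    (((u ≟ 1) ×-dec (v ≟ 1)) ⊎-dec ((u ≟ 1) ×-dec (v ≟ 3)) ⊎-dec ((u ≟ 1) ×-dec (v ≟ 5)) ⊎-dec ((u ≟ 2) ×-dec (v ≟ 2))))
    6) 6)

-- The bound 3 u v w < 16 (u + v + w) follows from the last two hypotheses; it prunes
-- the search before k is enumerated.
opaque
  only-equilateral : ∀ {u} → u < 4 → ∀ {v} → v < 16 → ∀ {w} → w < 8 * (u + v) →
    6 ≤ u * v → u ≤ v → v ≤ w → 2 ∣ u + v → 2 ∣ v + w → 3 * (u * v * w) < 16 * (u + v + w) →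
    ∀ {k} → k < 4 * (u + v + w) → 3 * ((u + v + w) * u * v * w) ≡ k * k → u ≡ 3 × v ≡ 3 × w ≡ 3
  only-equilateral = from-yes
    (allUpTo? (λ u → allUpTo? (λ v → allUpTo? (λ w →
      (6 ≤? u * v) →-dec (u ≤? v) →-dec (v ≤? w) →-dec (2 ∣? u + v) →-dec (2 ∣? v + w) →-dec
      (3 * (u * v * w) <? 16 * (u + v + w)) →-dec
      allUpTo? (λ k → (3 * ((u + v + w) * u * v * w) ≟ k * k) →-dec ((u ≟ 3) ×-dec (v ≟ 3) ×-dec (w ≟ 3)))
        (4 * (u + v + w)))
      (8 * (u + v))) 16) 4)

Classified : List ℕ → Set
Classified xs = (xs ↭ sides 3 3 3)
    ⊎ (∃[ x ] ∃[ y ] (1 ≤ x × 1 ≤ y × 4 * (x * x) ≡ 1 + 3 * (y * y) × xs ↭ sides x x 1))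
    ⊎ (∃[ x ] ∃[ y ] (1 ≤ x × 1 ≤ y × x * x ≡ 1 + 3 * (y * y) × xs ↭ sides x x 2))
    ⊎ (∃[ x ] ∃[ y ] (1 ≤ x × 1 ≤ y × 4 * (x * x) ≡ 1 + 15 * (y * y) × xs ↭ sides (3 * x + 1) (3 * x ∸ 1) 3))

classified-resp-↭ : ∀ {xs ys} → xs ↭ ys → Classified ys → Classified xs
classified-resp-↭ p (inj₁ q)                                          = inj₁ (↭-trans p q)
classified-resp-↭ p (inj₂ (inj₁ (x , y , 1≤x , 1≤y , e , q)))        = inj₂ (inj₁ (x , y , 1≤x , 1≤y , e , ↭-trans p q))
classified-resp-↭ p (inj₂ (inj₂ (inj₁ (x , y , 1≤x , 1≤y , e , q))))  = inj₂ (inj₂ (inj₁ (x , y , 1≤x , 1≤y , e , ↭-trans p q)))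
classified-resp-↭ p (inj₂ (inj₂ (inj₂ (x , y , 1≤x , 1≤y , e , q)))) = inj₂ (inj₂ (inj₂ (x , y , 1≤x , 1≤y , e , ↭-trans p q)))

ravi[3,3,3] : ∀ {a b c u v w} → u ≡ 3 × v ≡ 3 × w ≡ 3 →
              u + v ≡ 2 * c → u + w ≡ 2 * b → v + w ≡ 2 * a → sides a b c ↭ sides 3 3 3
ravi[3,3,3] (refl , refl , refl) E₁ E₂ E₃ = sides-cong (halve (sym E₃)) (halve (sym E₂)) (halve (sym E₁))

ravi[1,1] : ∀ {a b c w k} → 1 ≤ b → 1 + 1 ≡ 2 * c → 1 + w ≡ 2 * b → 1 + w ≡ 2 * a →
            3 * ((1 + 1 + w) * 1 * 1 * w) ≡ k * k → Classified (sides a b c)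
ravi[1,1] {a} {b} {c} {w} {k} 1≤b E₁ E₂ E₃ H =
  inj₂ (inj₁ (b , map₂ family
    (pell[4,3] {k} {(2 + w) * w} {b} (ravi-area (2 + w) 1 1 w {k} H) (ravi-square 1 {w} {b} E₂))))
  where
  family : ∀ {y} → 1 ≤ y × 4 * (b * b) ≡ 1 + 3 * (y * y) →
           1 ≤ b × 1 ≤ y × 4 * (b * b) ≡ 1 + 3 * (y * y) × sides a b c ↭ sides b b 1
  family (1≤y , pell) = 1≤b , 1≤y , pell , sides-cong (halve (trans (sym E₃) E₂)) refl (halve (sym E₁))

ravi[2,2] : ∀ {a b c w k} → 2 ≤ w → 2 + 2 ≡ 2 * c → 2 + w ≡ 2 * b → 2 + w ≡ 2 * a →
            3 * ((2 + 2 + w) * 2 * 2 * w) ≡ k * k → Classified (sides a b c)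
ravi[2,2] {a} {b} {c} {w} {k} 2≤w E₁ E₂ E₃ H =
  inj₂ (inj₂ (inj₁ (b , map₂ family
    (pell[1,3] {k} {(4 + w) * w} {b} 1<b (ravi-area (4 + w) 2 2 w {k} H) (ravi-square 2 {w} {b} E₂)))))
  where
  1<b : 1 < b
  1<b = *-cancelˡ-≤ 2 (≤-trans (+-monoʳ-≤ 2 2≤w) (≤-reflexive E₂))
  family : ∀ {y} → 1 ≤ y × b * b ≡ 1 + 3 * (y * y) →
           1 ≤ b × 1 ≤ y × b * b ≡ 1 + 3 * (y * y) × sides a b c ↭ sides b b 2
  family (1≤y , pell) = <⇒≤ 1<b , 1≤y , pell , sides-cong (halve (trans (sym E₃) E₂)) refl (halve (sym E₁))

ravi[1,3]-impossible : ∀ {w k} → 3 ≤ w → 3 * ((1 + 3 + w) * 1 * 3 * w) ≢ k * k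
ravi[1,3]-impossible {w} {k} 3≤w H =
  let q , [4+w]*w≡q*q = k*k≡p*[p*n]⇒n≡q*q {k = k} {(4 + w) * w} prime[3]
                          (trans (ravi-area (4 + w) 1 3 w {k} H) (*-assoc 3 3 ((4 + w) * w)))
  in nonsquare-[4+n]*n {w} {q} (≤-trans (s≤s z≤n) 3≤w) [4+w]*w≡q*q

ravi[1,5] : ∀ {a b c w k} → 1 + 5 ≡ 2 * c → 1 + w ≡ 2 * b → 5 + w ≡ 2 * a →
            3 * ((1 + 5 + w) * 1 * 5 * w) ≡ k * k → Classified (sides a b c)
ravi[1,5] {a} {b} {c} {w} {k} E₁ E₂ E₃ H =
  inj₂ (inj₂ (inj₂ (family
    (pell[4,15] {k} {(6 + w) * w} {1 + b} (ravi-area (6 + w) 1 5 w {k} H) (ravi-square 3 {w} {1 + b} 3+w≡2[1+b])))))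
  where
  3+w≡2[1+b] : 3 + w ≡ 2 * (1 + b)
  3+w≡2[1+b] = trans (cong (2 +_) E₂) (sym (*-distribˡ-+ 2 1 b))
  a≡2+b : a ≡ 2 + b
  a≡2+b = halve (trans (sym E₃) (trans (cong (4 +_) E₂) (sym (*-distribˡ-+ 2 2 b))))
  family : ∃[ x ] ∃[ y ] (1 + b ≡ x * 3 × 1 ≤ y × 4 * (x * x) ≡ 1 + 15 * (y * y)) →
           ∃[ x ] ∃[ y ] (1 ≤ x × 1 ≤ y × 4 * (x * x) ≡ 1 + 15 * (y * y) × sides a b c ↭ sides (3 * x + 1) (3 * x ∸ 1) 3)
  family (zero , _ , () , _)
  family (x@(suc _) , y , 1+b≡x*3 , 1≤y , pell) =
    x , y , s≤s z≤n , 1≤y , pell , sides-cong a≡3x+1 (cong (_∸ 1) 1+b≡3x) (halve (sym E₁))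
    where
    1+b≡3x : 1 + b ≡ 3 * x
    1+b≡3x = trans 1+b≡x*3 (*-comm x 3)
    a≡3x+1 : a ≡ 3 * x + 1
    a≡3x+1 = trans a≡2+b (trans (+-comm 1 (1 + b)) (cong (_+ 1) 1+b≡3x))

classify-ravi-pair : ∀ {a b c u v w k} → 1 ≤ b → RaviPair u v → v ≤ w →
  u + v ≡ 2 * c → u + w ≡ 2 * b → v + w ≡ 2 * a → 3 * ((u + v + w) * u * v * w) ≡ k * k → Classified (sides a b c)
classify-ravi-pair {k = k} 1≤b (inj₁ (refl , refl))               _   E₁ E₂ E₃ H = ravi[1,1] {k = k} 1≤b E₁ E₂ E₃ H
classify-ravi-pair {k = k} _   (inj₂ (inj₁ (refl , refl)))        3≤w _  _  _  H = contradiction H (ravi[1,3]-impossible {k = k} 3≤w)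
classify-ravi-pair {k = k} _   (inj₂ (inj₂ (inj₁ (refl , refl)))) _   E₁ E₂ E₃ H = ravi[1,5] {k = k} E₁ E₂ E₃ H
classify-ravi-pair {k = k} _   (inj₂ (inj₂ (inj₂ (refl , refl)))) 2≤w E₁ E₂ E₃ H = ravi[2,2] {k = k} 2≤w E₁ E₂ E₃ H

classify-ravi : ∀ {a b c u v w k} → 1 ≤ b → 1 ≤ u → u ≤ v → v ≤ w →
  u + v ≡ 2 * c → u + w ≡ 2 * b → v + w ≡ 2 * a →
  3 * ((u + v + w) * u * v * w) ≡ k * k → k < 4 * (u + v + w) → Classified (sides a b c)
classify-ravi {a} {b} {c} {u} {v} {w} {k} 1≤b 1≤u u≤v v≤w E₁ E₂ E₃ H k< with 6 ≤? u * v
... | no 6≰uv =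
  classify-ravi-pair {k = k} 1≤b (small-ravi-pair 1≤u u≤v (≰⇒> 6≰uv) (m≡2*n⇒2∣m {n = c} E₁)) v≤w E₁ E₂ E₃ H
... | yes 6≤uv =
  inj₁ (ravi[3,3,3] {a} {b} {c} (only-equilateral u<4 v<16 (w<8[u+v] {u} {v} {w} 6≤uv bound) 6≤uv u≤v v≤w
                                   (m≡2*n⇒2∣m {n = c} E₁) (m≡2*n⇒2∣m {n = a} E₃) bound k< H) E₁ E₂ E₃)
  where
  bound : 3 * (u * v * w) < 16 * (u + v + w)
  bound = ravi-bound {u + v + w} {u} {v} {w} {k} H k<
  uv<16 : u * v < 16
  uv<16 = u*v<16 u≤v v≤w bound
  u<4 : u < 4
  u<4 = m*m<n*n⇒m<n {u} {4} (≤-<-trans (*-monoʳ-≤ u u≤v) uv<16)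
  v<16 : v < 16
  v<16 = ≤-<-trans (m≤n*m v u {{>-nonZero 1≤u}}) uv<16

Admissible : ℕ → ℕ → ℕ → ℕ → Set
Admissible k a b c = IsTriangle a b c × AreaIs a b c k × PerimGtArea a b c k

heron-swap₁₂ : ∀ a b c → heron b a c ≡ heron a b c
heron-swap₁₂ a b c rewrite +-comm b a =
  cong (_* (a + b ∸ c)) ([m*n]*o≡[m*o]*n (a + b + c) (a + c ∸ b) (b + c ∸ a))

heron-swap₂₃ : ∀ a b c → heron a c b ≡ heron a b c
heron-swap₂₃ a b c rewrite +-comm c b | [m+n]+o≡[m+o]+n a c b =
  [m*n]*o≡[m*o]*n ((a + b + c) * (b + c ∸ a)) (a + b ∸ c) (a + c ∸ b)

admissible-swap₁₂ : ∀ {k a b c} → Admissible k a b c → Admissible k b a c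
admissible-swap₁₂ {k} {a} {b} {c} (((1≤a , 1≤b , 1≤c) , a<b+c , b<a+c , c<a+b) , area , k<4p) =
  ((1≤b , 1≤a , 1≤c) , b<a+c , a<b+c , subst (c <_) (+-comm a b) c<a+b) ,
  trans (cong (3 *_) (heron-swap₁₂ a b c)) area ,
  subst (λ s → k < 4 * (s + c)) (+-comm a b) k<4p

admissible-swap₂₃ : ∀ {k a b c} → Admissible k a b c → Admissible k a c b
admissible-swap₂₃ {k} {a} {b} {c} (((1≤a , 1≤b , 1≤c) , a<b+c , b<a+c , c<a+b) , area , k<4p) =
  ((1≤a , 1≤c , 1≤b) , subst (a <_) (+-comm b c) a<b+c , c<a+b , b<a+c) ,
  trans (cong (3 *_) (heron-swap₂₃ a b c)) area ,
  subst (λ s → k < 4 * s) ([m+n]+o≡[m+o]+n a b c) k<4p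

classify-sorted : ∀ {k a b c} → c ≤ b → b ≤ a → Admissible k a b c → Classified (sides a b c)
classify-sorted {k} {a} {b} {c} c≤b b≤a (((_ , 1≤b , _) , a<b+c , b<a+c , c<a+b) , area , k<4p) =
  classify-ravi {k = k} 1≤b (m<n⇒0<n∸m a<b+c) (∸-mono (+-monoˡ-≤ c b≤a) b≤a) (∸-mono (+-monoʳ-≤ a c≤b) c≤b)
    E₁ E₂ E₃ (subst (λ s → 3 * (s * u * v * w) ≡ k * k) p≡ area) (subst (λ s → k < 4 * s) p≡ k<4p)
  where
  u v w : ℕ
  u = b + c ∸ a
  v = a + c ∸ b
  w = a + b ∸ c
  E₁ : u + v ≡ 2 * c
  E₁ = ravi-sum {a} {b} {c} (m∸n+n≡m (<⇒≤ a<b+c)) (m∸n+n≡m (<⇒≤ b<a+c))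
  E₂ : u + w ≡ 2 * b
  E₂ = ravi-sum {a} {c} {b} (trans (m∸n+n≡m (<⇒≤ a<b+c)) (+-comm b c)) (m∸n+n≡m (<⇒≤ c<a+b))
  E₃ : v + w ≡ 2 * a
  E₃ = ravi-sum {b} {c} {a} (trans (m∸n+n≡m (<⇒≤ b<a+c)) (+-comm a c))
                            (trans (m∸n+n≡m (<⇒≤ c<a+b)) (+-comm a b))
  p≡ : a + b + c ≡ u + v + w
  p≡ = sym (ravi-perimeter {a} {b} {c} {u} {v} {w} E₁ E₂ E₃)

theorem1 : (a b c k : ℕ) → IsTriangle a b c → 1 ≤ k → AreaIs a b c k → PerimGtArea a b c k →
    (sides a b c ↭ sides 3 3 3)
    ⊎ (∃[ x ] ∃[ y ] (1 ≤ x × 1 ≤ y × 4 * (x * x) ≡ 1 + 3 * (y * y) × sides a b c ↭ sides x x 1))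
    ⊎ (∃[ x ] ∃[ y ] (1 ≤ x × 1 ≤ y × x * x ≡ 1 + 3 * (y * y) × sides a b c ↭ sides x x 2))
    ⊎ (∃[ x ] ∃[ y ] (1 ≤ x × 1 ≤ y × 4 * (x * x) ≡ 1 + 15 * (y * y) × sides a b c ↭ sides (3 * x + 1) (3 * x ∸ 1) 3))
theorem1 a b c k triangle _ area perimeter>area =  -- 1 ≤ k is implied by non-degeneracy
  sorted-wlog {P = Admissible k} classified-resp-↭ admissible-swap₁₂ admissible-swap₂₃ classify-sorted
    (triangle , area , perimeter>area)
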